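{- For every integer $k\ge 2$, $r(k,k+1)=2k$.
   Context: For a graph whose edges are coloured red and blue, a red (resp. blue) $t$-connected matching is a connected component of the spanning subgraph formed by the red (resp. blue) edges whose maximum matching has size at least $t$. For positive integers $k,l$, $r(k,l)$ denotes the smallest integer $n$ such that every red-blue colouring of the edges of $K_{n,n}$ contains a red $k$-connected matching or a blue $l$-connected matching. -}

module Defs where

open import Data.Nat using (ℕ; _<_)
open import Data.Fin using (Fin)
open import Data.Sum using (_⊎_; inj₁; inj₂)
open import Data.Product using (Σ; _×_; _,_; proj₁; proj₂; ∃)
open import Relation.Binary.PropositionalEquality using (_≡_)
open import Relation.Binary.Construct.Closure.ReflexiveTransitive using (Star)
open import Relation.Nullary using (¬_)
open import Function.Definitions using (Injective)

data Colour : Set where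
  red blue : Colour

-- A red-blue edge colouring of K_{n,n}: left vertex i and right vertex j
-- are joined by an edge of colour χ i j.
Colouring : ℕ → Set
Colouring n = Fin n → Fin n → Colour

-- Vertices of K_{n,n}: inj₁ i (left part), inj₂ j (right part).
Vertex : ℕ → Set
Vertex n = Fin n ⊎ Fin n

data Adj {n : ℕ} (χ : Colouring n) (c : Colour) : Vertex n → Vertex n → Set where
  lr : ∀ i j → χ i j ≡ c → Adj χ c (inj₁ i) (inj₂ j)
  rl : ∀ i j → χ i j ≡ c → Adj χ c (inj₂ j) (inj₁ i)

Reach : ∀ {n} → Colouring n → Colour → Vertex n → Vertex n → Set
Reach χ c = Star (Adj χ c)

ComponentHasMatching : ∀ {n} → Colouring n → Colour → ℕ → Vertex n → Set
ComponentHasMatching {n} χ c t v =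
  Σ (Fin t → Fin n) λ L → Σ (Fin t → Fin n) λ R →
    Injective _≡_ _≡_ L × Injective _≡_ _≡_ R ×
    (∀ s → χ (L s) (R s) ≡ c) ×
    (∀ s → Reach χ c v (inj₁ (L s)))

-- A colour-c t-connected matching: a component of the colour-c subgraph whose
-- maximum matching has size at least t.
HasConnectedMatching : ∀ {n} → Colouring n → Colour → ℕ → Set
HasConnectedMatching {n} χ c t = ∃ λ (v : Vertex n) → ComponentHasMatching χ c t v

RamseyProp : ℕ → ℕ → ℕ → Set
RamseyProp k l n = (χ : Colouring n) →
  HasConnectedMatching χ red k ⊎ HasConnectedMatching χ blue l

RamseyNumberIs : ℕ → ℕ → ℕ → Set
RamseyNumberIs k l m = RamseyProp k l m × (∀ n → n < m → ¬ RamseyProp k l n)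

-- Greedily matching the rows of K_{2k,2k} yields a red k-matching or a blue
-- K_{k+1,k+1}, and likewise a blue (k+1)-matching or a red K_{k,k}. If the red matching lies in
-- one red component we are done; otherwise let K be the red component of one of its left
-- vertices i₁ (matched to r₁) and i₂r₂ a matching edge outside K. Every edge leaving K is blue,
-- so every left vertex is blue-adjacent to r₁ or to r₂. If r₁ and r₂ are blue-connected, the blue
-- component of r₁ contains all left vertices and the blue greedy step finishes. If not, a blue
-- edge inside K or inside its complement would connect them, so K and its complement are red
-- bicliques joined by blue bicliques, and counting the four parts gives a red K_{k,k} or a blue
-- K_{k+1,k+1}.
--
-- Lower bound. For n < 2k colour ij red iff (i < k - 1) ⇔ (j < k). Each red component has fewer
-- than k vertices on one side, and each blue component fewer than k + 1.
--
-- Connectivity is decided by iterating one-step expansion of a subset of the (finite) vertex set,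
-- which must stop growing after as many steps as there are vertices.

module Submission where

open import Defs
open import Data.Bool using (Bool; true; false; not; T)
open import Data.Bool.Properties using (T-≡; not-injective)
open import Data.Nat using (ℕ; zero; suc; _+_; _*_; _∸_; _≤_; _<_; z≤n; s≤s; z<s; s<s; _≤?_; _<?_; _<ᵇ_)
open import Data.Nat.Properties
  using (≤-trans; ≤-<-trans; <⇒≤; ≤⇒≯; ≰⇒>; ≮⇒≥; <-irrefl; 1+n≰n; n≤1+n; +-comm; +-suc; +-identityʳ;
         +-mono-≤-<; +-mono-<-≤; +-cancelʳ-≤; m<m+n; ∸-monoˡ-<; ∸-cancelʳ-≡; m<n+o⇒m∸n<o; <ᵇ⇒<; <⇒<ᵇ)
open import Data.Nat.GeneralisedArithmetic using (fold)
open import Data.Nat.Tactic.RingSolver using (solve-∀)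
open import Data.Fin using (Fin; zero; suc; toℕ; fromℕ<; inject≤; punchIn)
open import Data.Fin.Properties
  using (any?; all?; ¬∀⟶∃¬; +↔⊎; suc-injective; punchIn-injective; punchInᵢ≢i; inject≤-injective;
         injective⇒≤; toℕ-injective; fromℕ<-injective; toℕ<n)
open import Data.Fin.Subset using (Subset; _∈_; _⊆_; _⊂_; _∪_; ⁅_⁆; ∣_∣)
open import Data.Fin.Subset.Properties
  using (_∈?_; _⊂?_; ⊆-antisym; p⊂q⇒∣p∣<∣q∣; ∣p∣≤n; p⊆p∪q; q⊆p∪q; x∈p∪q⁻; x∈⁅x⁆; x∈⁅y⁆⇒x≡y)
open import Data.Vec using (tabulate)
open import Data.Vec.Properties using (lookup∘tabulate; lookup⇒[]=; []=⇒lookup)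
open import Data.Vec.Functional using (_∷_)
open import Data.Product using (∃; ∃₂; Σ; _×_; _,_)
open import Data.Sum using (_⊎_; inj₁; inj₂; [_,_])
import Data.Sum as Sum
open import Function using (_∘_; _∘′_; id; _↔_; Inverse; Equivalence)
open import Function.Definitions using (Injective)
open import Relation.Binary using (Rel; Decidable; DecidableEquality)
open import Relation.Binary.Construct.Closure.ReflexiveTransitive using (Star; ε; _◅_; _◅◅_; gmap)
import Relation.Binary.Construct.Closure.ReflexiveTransitive as Closure
open import Relation.Binary.PropositionalEquality using (_≡_; _≢_; refl; sym; trans; cong; subst; subst₂)
open import Relation.Nullary using (¬_; yes; no; contradiction)
open import Relation.Nullary.Decidable using (_×-dec_; map′; ⌊_⌋; toWitness; fromWitness)
open import Relation.Unary using (Pred; ∁)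
import Relation.Unary as U

Closed : ∀ {m} → (Subset m → Subset m) → Subset m → Set
Closed F p = F p ⊆ p

module _ {m : ℕ} {F : Subset m → Subset m} (F-inflationary : ∀ p → p ⊆ F p) where

  closed⇒F-closed : ∀ {p} → Closed F p → Closed F (F p)
  closed⇒F-closed {p} closed = subst (Closed F) (⊆-antisym (F-inflationary p) closed) closed

  ⊄F⇒closed : ∀ {p} → ¬ (p ⊂ F p) → Closed F p
  ⊄F⇒closed {p} p⊄Fp {x} x∈Fp with x ∈? p
  ... | yes x∈p = x∈p
  ... | no  x∉p = contradiction ((λ {_} → F-inflationary p) , x , x∈Fp , x∉p) p⊄Fp

  iterate-closed⊎large : ∀ p t → Closed F (fold p F t) ⊎ t ≤ ∣ fold p F t ∣
  iterate-closed⊎large p zero = inj₂ z≤n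
  iterate-closed⊎large p (suc t) with iterate-closed⊎large p t
  ... | inj₁ closed = inj₁ (closed⇒F-closed closed)
  ... | inj₂ large with fold p F t ⊂? F (fold p F t)
  ...   | yes grows = inj₂ (≤-<-trans large (p⊂q⇒∣p∣<∣q∣ grows))
  ...   | no  stuck = inj₁ (closed⇒F-closed (⊄F⇒closed stuck))

  iterate-closed : ∀ p → Closed F (fold p F (suc m))
  iterate-closed p with iterate-closed⊎large p (suc m)
  ... | inj₁ closed = closed
  ... | inj₂ large  = contradiction (≤-trans large (∣p∣≤n (fold p F (suc m)))) 1+n≰n

module _ {m ℓ} {R : Rel (Fin m) ℓ} (R? : Decidable R) where

  successors : Subset m → Subset m
  successors p = tabulate λ w → ⌊ any? (λ u → u ∈? p ×-dec R? u w) ⌋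

  ∈-successors⁺ : ∀ {p u w} → u ∈ p → R u w → w ∈ successors p
  ∈-successors⁺ {w = w} u∈p Ruw =
    lookup⇒[]= w _ (trans (lookup∘tabulate _ w) (Equivalence.to T-≡ (fromWitness (_ , u∈p , Ruw))))

  ∈-successors⁻ : ∀ {p w} → w ∈ successors p → ∃ λ u → u ∈ p × R u w
  ∈-successors⁻ {p} {w} w∈ =
    toWitness {a? = any? λ u → u ∈? p ×-dec R? u w}
      (Equivalence.from T-≡ (trans (sym (lookup∘tabulate _ w)) ([]=⇒lookup w∈)))

  expand : Subset m → Subset m
  expand p = p ∪ successors p

  reachedWithin : Fin m → ℕ → Subset m
  reachedWithin x = fold ⁅ x ⁆ expand

  reachedWithin-sound : ∀ {x w} t → w ∈ reachedWithin x t → Star R x w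
  reachedWithin-sound {x} {w} zero w∈ with x∈⁅y⁆⇒x≡y x w∈
  ... | refl = ε
  reachedWithin-sound (suc t) w∈ with x∈p∪q⁻ _ _ w∈
  ... | inj₁ w∈earlier = reachedWithin-sound t w∈earlier
  ... | inj₂ w∈new with ∈-successors⁻ w∈new
  ...   | u , u∈ , Ruw = reachedWithin-sound t u∈ ◅◅ (Ruw ◅ ε)

  source-reached : ∀ x t → x ∈ reachedWithin x t
  source-reached x zero = x∈⁅x⁆ x
  source-reached x (suc t) = p⊆p∪q _ (source-reached x t)

  closed-star : ∀ {p u w} → Closed expand p → u ∈ p → Star R u w → w ∈ p
  closed-star closed u∈p ε = u∈p
  closed-star closed u∈p (Ruv ◅ path) =
    closed-star closed (closed (q⊆p∪q _ _ (∈-successors⁺ u∈p Ruv))) path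

  star? : Decidable (Star R)
  star? x w = map′ (reachedWithin-sound (suc m))
    (closed-star (iterate-closed (λ p → p⊆p∪q (successors p)) ⁅ x ⁆) (source-reached x (suc m)))
    (w ∈? reachedWithin x (suc m))

star?-finite : ∀ {a ℓ m} {A : Set a} {R : Rel A ℓ} → Fin m ↔ A → Decidable R → Decidable (Star R)
star?-finite {R = R} Fin↔A R? x y =
  map′ (subst₂ (Star R) (strictlyInverseˡ x) (strictlyInverseˡ y) ∘′ gmap to id)
       (gmap from λ {u} {v} → subst₂ R (sym (strictlyInverseˡ u)) (sym (strictlyInverseˡ v)))
       (star? (λ i j → R? (to i) (to j)) (from x) (from y))
  where open Inverse Fin↔A

star-invariant : ∀ {a b ℓ} {A : Set a} {B : Set b} {R : Rel A ℓ} (f : A → B) →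
                 (∀ {u v} → R u v → f u ≡ f v) → ∀ {u v} → Star R u v → f u ≡ f v
star-invariant f step = Closure.fold (λ u v → f u ≡ f v) (λ r eq → trans (step r) eq) refl

∷-injective : ∀ {m n} {x : Fin n} {f : Fin m → Fin n} →
              Injective _≡_ _≡_ f → (∀ s → f s ≢ x) → Injective _≡_ _≡_ (x ∷ f)
∷-injective f-inj fresh {zero}  {zero}  _    = refl
∷-injective f-inj fresh {zero}  {suc t} x≡ft = contradiction (sym x≡ft) (fresh t)
∷-injective f-inj fresh {suc s} {zero}  fs≡x = contradiction fs≡x (fresh s)
∷-injective f-inj fresh {suc s} {suc t} eq   = cong suc (f-inj eq)

Enumeration : ∀ {n p} → Pred (Fin n) p → ℕ → Set p
Enumeration {n} P t = Σ (Fin t → Fin n) λ f → Injective _≡_ _≡_ f × ∀ s → P (f s)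

module _ {n p} {P : Pred (Fin (suc n)) p} {t : ℕ} where

  enumeration-suc : Enumeration (P ∘ suc) t → Enumeration P t
  enumeration-suc (f , f-inj , f∈P) = suc ∘ f , f-inj ∘ suc-injective , f∈P

  enumeration-cons : P zero → Enumeration (P ∘ suc) t → Enumeration P (suc t)
  enumeration-cons P0 (f , f-inj , f∈P) =
    zero ∷ suc ∘ f , ∷-injective (f-inj ∘ suc-injective) (λ _ ()) , λ { zero → P0 ; (suc s) → f∈P s }

partition : ∀ {n p} {P : Pred (Fin n) p} → U.Decidable P →
            ∃₂ λ a b → a + b ≡ n × Enumeration P a × Enumeration (∁ P) b
partition {zero} {P = P} P? = 0 , 0 , refl , empty P , empty (∁ P)
  where
  empty : ∀ {q} (Q : Pred (Fin 0) q) → Enumeration Q 0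
  empty Q = (λ ()) , (λ { {()} }) , λ ()
partition {suc n} {P = P} P? with P? zero | partition (P? ∘ suc)
... | yes P0 | a , b , a+b≡n , as , bs =
  suc a , b , cong suc a+b≡n , enumeration-cons {P = P} P0 as , enumeration-suc {P = ∁ P} bs
... | no ¬P0 | a , b , a+b≡n , as , bs =
  a , suc b , trans (+-suc a b) (cong suc a+b≡n) ,
  enumeration-suc {P = P} as , enumeration-cons {P = ∁ P} ¬P0 bs

injective-<⇒≤ : ∀ {t m} (g : Fin t → ℕ) → Injective _≡_ _≡_ g → (∀ s → g s < m) → t ≤ m
injective-<⇒≤ g g-inj below = injective⇒≤ {f = λ s → fromℕ< (below s)}
  λ {s} {s′} eq → g-inj (fromℕ<-injective _ _ (below s) (below s′) eq)

module _ {t n m : ℕ} {f : Fin t → Fin n} (f-inj : Injective _≡_ _≡_ f) where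

  injective-below⇒≤ : (∀ s → toℕ (f s) < m) → t ≤ m
  injective-below⇒≤ = injective-<⇒≤ (toℕ ∘ f) (f-inj ∘ toℕ-injective)

  injective-above⇒≤ : (∀ s → m ≤ toℕ (f s)) → t ≤ n ∸ m
  injective-above⇒≤ above = injective-<⇒≤ (λ s → toℕ (f s) ∸ m)
    (λ eq → f-inj (toℕ-injective (∸-cancelʳ-≡ (above _) (above _) eq)))
    (λ s → ∸-monoˡ-< (toℕ<n (f s)) (above s))

module _ {k a b : ℕ} (a+b≡2k : a + b ≡ 2 * k) where

  private
    a+b≡k+k : a + b ≡ k + k
    a+b≡k+k = trans a+b≡2k (cong (k +_) (+-identityʳ k))

  ≮⇒complement-≥ : ¬ k < a → k ≤ b
  ≮⇒complement-≥ k≮a = ≮⇒≥ λ b<k → <-irrefl a+b≡k+k (+-mono-≤-< (≮⇒≥ k≮a) b<k)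

  ≰⇒complement-> : ¬ k ≤ a → k < b
  ≰⇒complement-> k≰a = ≰⇒> λ b≤k → <-irrefl a+b≡k+k (+-mono-<-≤ (≰⇒> k≰a) b≤k)

quadrants : ∀ {k a b c d} → a + b ≡ 2 * k → c + d ≡ 2 * k →
            (k ≤ a × k ≤ c) ⊎ (k ≤ b × k ≤ d) ⊎ (k < a × k < d) ⊎ (k < b × k < c)
quadrants {k} {a} {_} {c} a+b c+d with k ≤? a | k ≤? c | k <? a | k <? c
... | yes k≤a | yes k≤c | _       | _       = inj₁ (k≤a , k≤c)
... | yes _   | no  k≰c | yes k<a | _       = inj₂ (inj₂ (inj₁ (k<a , ≰⇒complement-> c+d k≰c)))
... | yes _   | no  k≰c | no  k≮a | _       =
  inj₂ (inj₁ (≮⇒complement-≥ a+b k≮a , <⇒≤ (≰⇒complement-> c+d k≰c)))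
... | no  k≰a | _       | _       | yes k<c = inj₂ (inj₂ (inj₂ (≰⇒complement-> a+b k≰a , k<c)))
... | no  k≰a | _       | _       | no  k≮c =
  inj₂ (inj₁ (<⇒≤ (≰⇒complement-> a+b k≰a) , ≮⇒complement-≥ c+d k≮c))

<-+⇒≤ : ∀ {n s t x} → s + t ≡ suc n → n < x + t → s ≤ x
<-+⇒≤ {t = t} {x} s+t≡1+n n<x+t = +-cancelʳ-≤ t _ x (subst (_≤ x + t) (sym s+t≡1+n) n<x+t)

<-+-suc : ∀ {a x} t → a < x + t → suc a < x + suc t
<-+-suc {a} {x} t a<x+t = subst (suc a <_) (sym (+-suc x t)) (s<s a<x+t)

<ᵇ≡true⇒< : ∀ {m n} → (m <ᵇ n) ≡ true → m < n
<ᵇ≡true⇒< {m} {n} eq = <ᵇ⇒< m n (Equivalence.from T-≡ eq)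

<ᵇ≡false⇒≥ : ∀ {m n} → (m <ᵇ n) ≡ false → n ≤ m
<ᵇ≡false⇒≥ eq = ≮⇒≥ λ m<n → subst T eq (<⇒<ᵇ m<n)

other : Colour → Colour
other red  = blue
other blue = red

_≟ᶜ_ : DecidableEquality Colour
red  ≟ᶜ red  = yes refl
red  ≟ᶜ blue = no λ ()
blue ≟ᶜ red  = no λ ()
blue ≟ᶜ blue = yes refl

≢⇒other : ∀ {a c} → a ≢ c → a ≡ other c
≢⇒other {red}  {red}  a≢c = contradiction refl a≢c
≢⇒other {red}  {blue} _   = refl
≢⇒other {blue} {red}  _   = refl
≢⇒other {blue} {blue} a≢c = contradiction refl a≢c

colourByAgreement : Bool → Bool → Colour
colourByAgreement true  true  = red
colourByAgreement false false = red
colourByAgreement true  false = blue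
colourByAgreement false true  = blue

agreement-red : ∀ {x y} → colourByAgreement x y ≡ red → x ≡ y
agreement-red {true}  {true}  _ = refl
agreement-red {false} {false} _ = refl

agreement-blue : ∀ {x y} → colourByAgreement x y ≡ blue → x ≡ not y
agreement-blue {true}  {false} _ = refl
agreement-blue {false} {true}  _ = refl

module _ {a b : ℕ} where

  Matching : (Fin a → Fin b → Colour) → Colour → ℕ → Set
  Matching χ c t = Σ (Fin t → Fin a) λ L → Σ (Fin t → Fin b) λ R →
    Injective _≡_ _≡_ L × Injective _≡_ _≡_ R × ∀ s → χ (L s) (R s) ≡ c

  Biclique : (Fin a → Fin b → Colour) → Colour → ℕ → ℕ → Set
  Biclique χ c x y = Σ (Fin x → Fin a) λ X → Σ (Fin y → Fin b) λ Y →
    Injective _≡_ _≡_ X × Injective _≡_ _≡_ Y × ∀ s s′ → χ (X s) (Y s′) ≡ c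

  LargeBiclique : (Fin a → Fin b → Colour) → Colour → ℕ → Set
  LargeBiclique χ c t = ∃₂ λ x y → Biclique χ c x y × a < x + t × b < y + t

module _ {a b t : ℕ} {χ : Fin (suc a) → Fin b → Colour} {c : Colour}
         (blank : ∀ j → χ zero j ≡ other c) where

  matching-skipRow : Matching (χ ∘ suc) c t → Matching χ c t
  matching-skipRow (L , R , L-inj , R-inj , col) = suc ∘ L , R , L-inj ∘ suc-injective , R-inj , col

  largeBiclique-addRow : LargeBiclique (χ ∘ suc) (other c) t → LargeBiclique χ (other c) t
  largeBiclique-addRow (x , y , (X , Y , X-inj , Y-inj , col) , a<x+t , b<y+t) =
    suc x , y , (zero ∷ suc ∘ X , Y , ∷-injective (X-inj ∘ suc-injective) (λ _ ()) , Y-inj , colour) ,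
    s<s a<x+t , b<y+t
    where
    colour : ∀ s s′ → χ ((zero ∷ suc ∘ X) s) (Y s′) ≡ other c
    colour zero    s′ = blank (Y s′)
    colour (suc s) s′ = col s s′

module _ {a b t : ℕ} (j : Fin (suc b)) {χ : Fin (suc a) → Fin (suc b) → Colour} where

  matching-addEdge : ∀ {c} → χ zero j ≡ c →
                     Matching (λ i k → χ (suc i) (punchIn j k)) c t → Matching χ c (suc t)
  matching-addEdge χ0j≡c (L , R , L-inj , R-inj , col) =
    zero ∷ suc ∘ L , j ∷ punchIn j ∘ R ,
    ∷-injective (L-inj ∘ suc-injective) (λ _ ()) ,
    ∷-injective (R-inj ∘ punchIn-injective j _ _) (λ s → punchInᵢ≢i j (R s)) ,
    λ { zero → χ0j≡c ; (suc s) → col s }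

  largeBiclique-deleteEdge : ∀ {d} → LargeBiclique (λ i k → χ (suc i) (punchIn j k)) d t →
                             LargeBiclique χ d (suc t)
  largeBiclique-deleteEdge (x , y , (X , Y , X-inj , Y-inj , col) , a<x+t , b<y+t) =
    x , y , (suc ∘ X , punchIn j ∘ Y , X-inj ∘ suc-injective , Y-inj ∘ punchIn-injective j _ _ , col) ,
    <-+-suc t a<x+t , <-+-suc t b<y+t

-- Match the first row along an edge of colour c if it has one, deleting that edge's column;
-- otherwise the whole row has colour other c and joins the biclique.
matching⊎largeBiclique : ∀ a b (χ : Fin a → Fin b → Colour) c t →
                         Matching χ c t ⊎ LargeBiclique χ (other c) t
matching⊎largeBiclique a b χ c zero = inj₁ ((λ ()) , (λ ()) , (λ { {()} }) , (λ { {()} }) , λ ())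
matching⊎largeBiclique zero b χ c (suc t) =
  inj₂ (0 , b , ((λ ()) , id , (λ { {()} }) , id , λ ()) , s≤s z≤n , m<m+n b z<s)
matching⊎largeBiclique (suc a) zero χ c (suc t) =
  Sum.map (matching-skipRow {χ = χ} blank) (largeBiclique-addRow {χ = χ} blank)
          (matching⊎largeBiclique a zero (χ ∘ suc) c (suc t))
  where
  blank : ∀ j → χ zero j ≡ other c
  blank ()
matching⊎largeBiclique (suc a) (suc b) χ c (suc t) with any? (λ j → χ zero j ≟ᶜ c)
... | yes (j , χ0j≡c) =
  Sum.map (matching-addEdge j {χ} χ0j≡c) (largeBiclique-deleteEdge j {χ})
          (matching⊎largeBiclique a b (λ i k → χ (suc i) (punchIn j k)) c t)
... | no noEdge =
  Sum.map (matching-skipRow {χ = χ} blank) (largeBiclique-addRow {χ = χ} blank)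
          (matching⊎largeBiclique a (suc b) (χ ∘ suc) c (suc t))
  where
  blank : ∀ j → χ zero j ≡ other c
  blank j = ≢⇒other λ χ0j≡c → noEdge (j , χ0j≡c)

module _ {n} (χ : Colouring n) (c : Colour) where

  adj? : Decidable (Adj χ c)
  adj? (inj₁ i) (inj₁ i′) = no λ ()
  adj? (inj₁ i) (inj₂ j)  = map′ (lr i j) (λ { (lr _ _ χij≡c) → χij≡c }) (χ i j ≟ᶜ c)
  adj? (inj₂ j) (inj₁ i)  = map′ (rl i j) (λ { (rl _ _ χij≡c) → χij≡c }) (χ i j ≟ᶜ c)
  adj? (inj₂ j) (inj₂ j′) = no λ ()

  reach? : Decidable (Reach χ c)
  reach? = star?-finite +↔⊎ adj?

  module _ {z : Vertex n} {i j : Fin n} where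

    crossing-colourˡ : Reach χ c z (inj₁ i) → ¬ Reach χ c z (inj₂ j) → χ i j ≡ other c
    crossing-colourˡ z⇝i z↛j = ≢⇒other λ χij≡c → z↛j (z⇝i ◅◅ lr i j χij≡c ◅ ε)

    crossing-colourʳ : Reach χ c z (inj₂ j) → ¬ Reach χ c z (inj₁ i) → χ i j ≡ other c
    crossing-colourʳ z⇝j z↛i = ≢⇒other λ χij≡c → z↛i (z⇝j ◅◅ rl i j χij≡c ◅ ε)

  biclique⇒connectedMatching : ∀ {x y t} → Biclique χ c x y → t ≤ x → t ≤ y → 0 < t →
                               HasConnectedMatching χ c t
  biclique⇒connectedMatching (X , Y , X-inj , Y-inj , col) t≤x t≤y t>0 =
    inj₁ (L s₀) , L , R ,
    inject≤-injective t≤x t≤x _ _ ∘ X-inj , inject≤-injective t≤y t≤y _ _ ∘ Y-inj ,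
    (λ s → col _ _) , λ s → lr (L s₀) (R s₀) (col _ _) ◅ rl (L s) (R s₀) (col _ _) ◅ ε
    where
    L = λ s → X (inject≤ s t≤x)
    R = λ s → Y (inject≤ s t≤y)
    s₀ = fromℕ< t>0

  enumerations⇒biclique : ∀ {p q} {P : Pred (Fin n) p} {Q : Pred (Fin n) q} {x y} →
                          Enumeration P x → Enumeration Q y → (∀ {i j} → P i → Q j → χ i j ≡ c) →
                          Biclique χ c x y
  enumerations⇒biclique (X , X-inj , X∈P) (Y , Y-inj , Y∈Q) col =
    X , Y , X-inj , Y-inj , λ s s′ → col (X∈P s) (Y∈Q s′)

module UpperBound (k : ℕ) (k>0 : 0 < k) (χ : Colouring (2 * k)) where

  RedOrBlue : Set
  RedOrBlue = HasConnectedMatching χ red k ⊎ HasConnectedMatching χ blue (suc k)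

  blue-from-largeBiclique : LargeBiclique χ blue k → HasConnectedMatching χ blue (suc k)
  blue-from-largeBiclique (x , y , B , 2k<x+k , 2k<y+k) =
    biclique⇒connectedMatching χ blue B (<-+⇒≤ (1+k+k≡1+2k k) 2k<x+k) (<-+⇒≤ (1+k+k≡1+2k k) 2k<y+k)
      z<s
    where
    1+k+k≡1+2k : ∀ k → suc k + k ≡ suc (2 * k)
    1+k+k≡1+2k = solve-∀

  red-from-largeBiclique : LargeBiclique χ red (suc k) → HasConnectedMatching χ red k
  red-from-largeBiclique (x , y , B , 2k<x+k+1 , 2k<y+k+1) =
    biclique⇒connectedMatching χ red B
      (<-+⇒≤ (k+1+k≡1+2k k) 2k<x+k+1) (<-+⇒≤ (k+1+k≡1+2k k) 2k<y+k+1) k>0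
    where
    k+1+k≡1+2k : ∀ k → k + suc k ≡ suc (2 * k)
    k+1+k≡1+2k = solve-∀

  module TwoRedComponents (i₁ r₁ i₂ r₂ : Fin (2 * k)) (i₁r₁ : χ i₁ r₁ ≡ red) (i₂r₂ : χ i₂ r₂ ≡ red)
                          (i₂∉K : ¬ Reach χ red (inj₁ i₁) (inj₁ i₂)) where

    K : Vertex (2 * k) → Set
    K = Reach χ red (inj₁ i₁)

    r₁∈K : K (inj₂ r₁)
    r₁∈K = lr i₁ r₁ i₁r₁ ◅ ε

    r₂∉K : ¬ K (inj₂ r₂)
    r₂∉K r₂∈K = i₂∉K (r₂∈K ◅◅ rl i₂ r₂ i₂r₂ ◅ ε)

    Linked : Set
    Linked = Reach χ blue (inj₂ r₁) (inj₂ r₂)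

    linked⇒left-reachable : Linked → ∀ x → Reach χ blue (inj₂ r₁) (inj₁ x)
    linked⇒left-reachable r₁⇝r₂ x with reach? χ red (inj₁ i₁) (inj₁ x)
    ... | yes x∈K = r₁⇝r₂ ◅◅ rl x r₂ (crossing-colourˡ χ red x∈K r₂∉K) ◅ ε
    ... | no  x∉K = rl x r₁ (crossing-colourʳ χ red r₁∈K x∉K) ◅ ε

    linked-case : Linked → RedOrBlue
    linked-case r₁⇝r₂ with matching⊎largeBiclique _ _ χ blue (suc k)
    ... | inj₁ (L , R , L-inj , R-inj , col) =
      inj₂ (inj₂ r₁ , L , R , L-inj , R-inj , col , λ s → linked⇒left-reachable r₁⇝r₂ (L s))
    ... | inj₂ big = inj₁ (red-from-largeBiclique big)

    module _ (unlinked : ¬ Linked) where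

      red-inside : ∀ {x w} → K (inj₁ x) → K (inj₂ w) → χ x w ≡ red
      red-inside {x} {w} x∈K w∈K = ≢⇒other λ χxw≡blue → unlinked
        (rl i₂ r₁ (crossing-colourʳ χ red r₁∈K i₂∉K) ◅ lr i₂ w (crossing-colourʳ χ red w∈K i₂∉K) ◅
         rl x w χxw≡blue ◅ lr x r₂ (crossing-colourˡ χ red x∈K r₂∉K) ◅ ε)

      red-outside : ∀ {x w} → ¬ K (inj₁ x) → ¬ K (inj₂ w) → χ x w ≡ red
      red-outside {x} {w} x∉K w∉K = ≢⇒other λ χxw≡blue → unlinked
        (rl x r₁ (crossing-colourʳ χ red r₁∈K x∉K) ◅ lr x w χxw≡blue ◅
         rl i₁ w (crossing-colourˡ χ red ε w∉K) ◅ lr i₁ r₂ (crossing-colourˡ χ red ε r₂∉K) ◅ ε)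

      unlinked-case : RedOrBlue
      unlinked-case with partition (λ i → reach? χ red (inj₁ i₁) (inj₁ i))
                       | partition (λ j → reach? χ red (inj₁ i₁) (inj₂ j))
      ... | a , b , a+b , A , B | c , d , c+d , C , D with quadrants a+b c+d
      ... | inj₁ (k≤a , k≤c) =
        inj₁ (biclique⇒connectedMatching χ red (enumerations⇒biclique χ red A C red-inside) k≤a k≤c k>0)
      ... | inj₂ (inj₁ (k≤b , k≤d)) =
        inj₁ (biclique⇒connectedMatching χ red (enumerations⇒biclique χ red B D red-outside) k≤b k≤d k>0)
      ... | inj₂ (inj₂ (inj₁ (k<a , k<d))) =
        inj₂ (biclique⇒connectedMatching χ blue
               (enumerations⇒biclique χ blue A D (crossing-colourˡ χ red)) k<a k<d z<s)
      ... | inj₂ (inj₂ (inj₂ (k<b , k<c))) =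
        inj₂ (biclique⇒connectedMatching χ blue
               (enumerations⇒biclique χ blue B C λ x∉K w∈K → crossing-colourʳ χ red w∈K x∉K) k<b k<c z<s)

    result : RedOrBlue
    result with reach? χ blue (inj₂ r₁) (inj₂ r₂)
    ... | yes linked   = linked-case linked
    ... | no  unlinked = unlinked-case unlinked

  s₀ : Fin k
  s₀ = fromℕ< k>0

  result : RedOrBlue
  result with matching⊎largeBiclique _ _ χ red k
  ... | inj₂ big = inj₂ (blue-from-largeBiclique big)
  ... | inj₁ (L , R , L-inj , R-inj , col) with all? (λ s → reach? χ red (inj₁ (L s₀)) (inj₁ (L s)))
  ...   | yes connected = inj₁ (inj₁ (L s₀) , L , R , L-inj , R-inj , col , connected)
  ...   | no  disconnected with ¬∀⟶∃¬ k _ (λ s → reach? χ red (inj₁ (L s₀)) (inj₁ (L s))) disconnected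
  ...     | s , L₀↛Ls = TwoRedComponents.result (L s₀) (R s₀) (L s) (R s) (col s₀) (col s) L₀↛Ls

ramsey-upper : ∀ k → 0 < k → RamseyProp k (k + 1) (2 * k)
ramsey-upper k k>0 χ =
  Sum.map₂ (subst (HasConnectedMatching χ blue) (+-comm 1 k)) (UpperBound.result k k>0 χ)

module LowerBound (k n : ℕ) (n<2k+2 : n < 2 * suc k) where

  smallˡ smallʳ : Fin n → Bool
  smallˡ i = toℕ i <ᵇ k
  smallʳ j = toℕ j <ᵇ suc k

  χ : Colouring n
  χ i j = colourByAgreement (smallˡ i) (smallʳ j)

  redSide blueSide : Vertex n → Bool
  redSide  = [ smallˡ , smallʳ ]
  blueSide = [ smallˡ , not ∘ smallʳ ]

  redSide-invariant : ∀ {u v} → Reach χ red u v → redSide u ≡ redSide v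
  redSide-invariant = star-invariant redSide
    λ { (lr i j χij≡red) → agreement-red χij≡red ; (rl i j χij≡red) → sym (agreement-red χij≡red) }

  blueSide-invariant : ∀ {u v} → Reach χ blue u v → blueSide u ≡ blueSide v
  blueSide-invariant = star-invariant blueSide
    λ { (lr i j χij≡blue) → agreement-blue χij≡blue ; (rl i j χij≡blue) → sym (agreement-blue χij≡blue) }

  module _ {t : ℕ} {v : Vertex n} {L : Fin t → Fin n} where

    redSide-matched : (∀ s → Reach χ red v (inj₁ (L s))) → ∀ s → smallˡ (L s) ≡ redSide v
    redSide-matched v⇝L s = sym (redSide-invariant (v⇝L s))

    blueSide-matched : (∀ s → Reach χ blue v (inj₁ (L s))) → ∀ s → smallˡ (L s) ≡ blueSide v
    blueSide-matched v⇝L s = sym (blueSide-invariant (v⇝L s))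

  no-red : ¬ HasConnectedMatching χ red (suc k)
  no-red (v , L , R , L-inj , R-inj , col , v⇝L) with redSide v in side
  ... | true  = 1+n≰n (injective-below⇒≤ L-inj λ s → <ᵇ≡true⇒< (trans (redSide-matched v⇝L s) side))
  ... | false = ≤⇒≯ (injective-above⇒≤ R-inj λ s → <ᵇ≡false⇒≥ {n = suc k} (right-large s)) n∸[k+1]<k+1
    where
    right-large : ∀ s → smallʳ (R s) ≡ false
    right-large s = trans (sym (agreement-red (col s))) (trans (redSide-matched v⇝L s) side)
    n∸[k+1]<k+1 : n ∸ suc k < suc k
    n∸[k+1]<k+1 = m<n+o⇒m∸n<o n (suc k) (subst (n <_) (cong (suc k +_) (+-identityʳ (suc k))) n<2k+2)

  no-blue : ¬ HasConnectedMatching χ blue (suc k + 1)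
  no-blue (v , L , R , L-inj , R-inj , col , v⇝L) with blueSide v in side
  ... | true  = ≤⇒≯ (≤-trans (injective-below⇒≤ L-inj left-small) (n≤1+n k)) (m<m+n (suc k) z<s)
    where
    left-small : ∀ s → toℕ (L s) < k
    left-small s = <ᵇ≡true⇒< (trans (blueSide-matched v⇝L s) side)
  ... | false = ≤⇒≯ (injective-below⇒≤ R-inj λ s → <ᵇ≡true⇒< (right-small s)) (m<m+n (suc k) z<s)
    where
    right-small : ∀ s → smallʳ (R s) ≡ true
    right-small s =
      not-injective (trans (sym (agreement-blue (col s))) (trans (blueSide-matched v⇝L s) side))

ramsey-lower : ∀ k n → n < 2 * suc k → ¬ RamseyProp (suc k) (suc k + 1) n
ramsey-lower k n n<2k+2 ramsey = [ no-red , no-blue ] (ramsey χ)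
  where open LowerBound k n n<2k+2

lemma3p2 : (k : ℕ) → 2 ≤ k → RamseyNumberIs k (k + 1) (2 * k)
lemma3p2 (suc k) _ = ramsey-upper (suc k) z<s , ramsey-lower k
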